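{- In the Littlestone construction described in the context, for any non-repetitive set $S_{\mathrm{nr}}\subseteq\mathcal{X}$ and any depth-$d$ mistake tree $\mathcal{T}$ of $(\mathcal{C}[S_{\mathrm{nr}}],\mathcal{X})$, there exists a leaf $s\in\{0,1\}^d$ such that $|IJ(\rho^{ -1}_{\mathcal{T},s}(1))\setminus IJ(S_{\mathrm{nr}})|\ge d-r$.
   Context: Label Cover: $\mathcal{L}=(A,B,E,\Sigma,\{\pi_e\}_{e\in E})$, bipartite graph $(A,B,E)$, finite alphabet $\Sigma$, maps $\pi_{(a,b)}:\Sigma\to\Sigma$, bi-regular. A partial assignment defined on both endpoints of $(a,b)$ violates it if $\pi_{(a,b)}(\sigma(a))\ne\sigma(b)$. $\Sigma^V$ = functions $V\to\Sigma$. Littlestone construction: $n=|A|+|B|$, $r=\sqrt{n}/\log n$ (even), $U_1,\dots,U_r$ a partition of $A\cup B$ with $n/(2r)\le|U_i|\le2n/r$ and $|E|/(2r^2)\le|(U_i\times U_j)\cap E|,|(U_j\times U_i)\cap E|\le2|E|/r^2$; for $i\ne j$, $\mathcal{N}_i(j)\subseteq U_i$ are the vertices of $U_i$ with a neighbor in $U_j$, $\mathcal{N}_i(J)=\bigcup_{j\in J}\mathcal{N}_i(j)$. $k=10^{10}|E|\log|\Sigma|/r^2$. $\mathcal{U}=\mathcal{X}\cup\mathcal{Y}$, $\mathcal{X}=\{x_{i,\sigma_i,j}:i\in[r],\sigma_i\in\Sigma^{U_i},j\in[k]\}$, $\mathcal{Y}=\{y_{I,i,j}:I\subseteq[r]\times[k],i\in[r],j\in[k]\}$.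 $\ell=1000$. For each $\tilde H\subseteq[r]$, pick $\ell$ random permutations of $[r]$, each giving the perfect matching pairing positions $2m-1,2m$; $M_{\tilde H}(i)$ is the set of indices matched with $i$, $T_{\tilde H}=\bigcup_i\mathcal{N}_i(M_{\tilde H}(i))$. $\tau(H)=\{i\in[r]:|\{j:(i,j)\in H\}|\ge k/2\}$. For every $I,H\subseteq[r]\times[k]$ and $\sigma\in\Sigma^{T_{\tau(H)}}$ violating no edge inside $T_{\tau(H)}$, concept $C_{I,H,\sigma}$ contains $x_{i,\sigma_i,j}$ iff $(i,j)\in I$ and $\sigma_i,\sigma$ agree on $\mathcal{N}_i(M_{\tau(H)}(i))$, and contains $y_{I',i,j}$ iff $(i,j)\in H$ and $I'=I$; $\mathcal{C}$ is the set of these concepts. $\mathcal{C}[S]=\{C\in\mathcal{C}:S\subseteq C\}$. Notation: $\mathcal{X}_{i,j}=\{x_{i,\sigma_i,j}:\sigma_i\in\Sigma^{U_i}\}$; $IJ(S)=\{(i,j):S\cap\mathcal{X}_{i,j}\ne\emptyset\}$; $S\subseteq\mathcal{X}$ is non-repetitive if $|S\cap\mathcal{X}_{i,j}|\le1$ for all $(i,j)$. A depth-$d$ mistake tree of $(\mathcal{C}',\mathcal{U}')$ is a full binary tree of depth $d$ with internal nodes $s\in\{0,1\}^{<d}$ labeled $v_{\mathcal{T},s}\in\mathcal{U}'$ such that each leaf $\ell'\in\{0,1\}^d$ has $C\in\mathcal{C}'$ with $v_{\mathcal{T},\ell'_{\le i}}\in C\iff\ell'_{i+1}=1$ for all $i<d$.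 For a node $s$, $\rho_{\mathcal{T},s}$ maps each element $v_{\mathcal{T},s'}$ for $s'$ a proper prefix of $s$ to $s_{|s'|+1}$; so $\rho^{ -1}_{\mathcal{T},s}(1)$ is the set of elements on the root-to-$s$ path at which the path branches to $1$. -}

module Defs where

open import Data.Nat using (ℕ; zero; suc; _+_; _*_; _∸_; _≤_; _/_)
open import Data.Nat.Divisibility using (_∣_)
open import Data.Bool using (Bool; true; false; if_then_else_; _∧_; not)
open import Data.Fin using (Fin; toℕ; _≟_)
open import Data.Fin.Permutation using (Permutation′; _⟨$⟩ˡ_)
open import Data.Vec using (Vec; []; _∷_; tabulate; sum; lookup)
open import Data.List using (List; []; _∷_)
open import Data.List.Relation.Unary.All using (All)
open import Data.List.Relation.Unary.Any using (Any)
open import Data.List.Membership.Propositional using (_∈_)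
open import Data.Sum using (_⊎_; inj₁; inj₂)
open import Data.Product using (Σ; _×_; _,_; ∃)
open import Relation.Binary.PropositionalEquality using (_≡_; _≢_)
open import Relation.Nullary.Decidable using (⌊_⌋)
open import Data.Nat using (_≤?_)
open import Data.Empty using (⊥)
open import Data.Unit using (⊤)
open import Relation.Nullary using (¬_)

count : ∀ {m} → (Fin m → Bool) → ℕ
count f = sum (tabulate (λ x → if f x then 1 else 0))

-- Label Cover instance  (A , B , E , Σ , {π_e}) ; A = Fin a, B = Fin b,
-- Σ = Fin q.  E is a Boolean adjacency relation, π a b is π_(a,b).

record LabelCover : Set where
  field
    a b q : ℕ
    E : Fin a → Fin b → Bool
    π : Fin a → Fin b → Fin q → Fin q
    degA : ℕ
    degB : ℕ
    regA : ∀ x → count (E x) ≡ degA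
    regB : ∀ y → count (λ x → E x y) ≡ degB

  V : Set
  V = Fin a ⊎ Fin b

  n : ℕ
  n = a + b

  numE : ℕ
  numE = sum (tabulate (λ x → count (E x)))

  Adj : V → V → Set
  Adj (inj₁ x) (inj₂ y) = E x y ≡ true
  Adj (inj₂ y) (inj₁ x) = E x y ≡ true
  Adj (inj₁ _) (inj₁ _) = ⊥
  Adj (inj₂ _) (inj₂ _) = ⊥

-- The data of the Littlestone construction over a label cover instance:
-- the number of parts r (even), the partition U_1..U_r (given by the map
-- part : V → Fin r, U_i = part⁻¹ i) satisfying the size and edge bounds,
-- the parameter k, and the ℓ = 1000 permutations chosen for every
-- H̃ ⊆ [r]  (the construction must hold for every outcome of the choice).

ℓ : ℕ
ℓ = 1000

record Construction (L : LabelCover) : Set where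
  open LabelCover L
  field
    r k : ℕ
    r-even : 2 ∣ r
    part : V → Fin r
  sizeU : Fin r → ℕ
  sizeU i = count (λ x → ⌊ part (inj₁ x) ≟ i ⌋) + count (λ y → ⌊ part (inj₂ y) ≟ i ⌋)
  edges : Fin r → Fin r → ℕ
  edges i j = sum (tabulate (λ x → count (λ y →
                 E x y ∧ ⌊ part (inj₁ x) ≟ i ⌋ ∧ ⌊ part (inj₂ y) ≟ j ⌋)))
  field
    sizeU-lower : ∀ i → n ≤ 2 * r * sizeU i
    sizeU-upper : ∀ i → r * sizeU i ≤ 2 * n
    edges-lower : ∀ i j → numE ≤ 2 * (r * r) * edges i j
    edges-upper : ∀ i j → (r * r) * edges i j ≤ 2 * numE
    perms : Vec Bool r → Fin ℓ → Permutation′ r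

  -- the permutation p, read as the sequence p(1),…,p(r), pairs the entries
  -- at positions 2m-1 and 2m; j is matched with i iff i ≠ j and their
  -- positions lie in the same pair (same quotient by 2, 0-indexed).
  MatchedIn : Permutation′ r → Fin r → Fin r → Set
  MatchedIn p i j = (i ≢ j) × (toℕ (p ⟨$⟩ˡ i) / 2 ≡ toℕ (p ⟨$⟩ˡ j) / 2)

  M : Vec Bool r → Fin r → Fin r → Set
  M H̃ i j = Σ (Fin ℓ) λ t → MatchedIn (perms H̃ t) i j

  N : Fin r → Fin r → V → Set
  N i j v = (part v ≡ i) × Σ V (λ w → Adj v w × (part w ≡ j))

  NM : Vec Bool r → Fin r → V → Set
  NM H̃ i v = Σ (Fin r) λ j → M H̃ i j × N i j v

  T : Vec Bool r → V → Set
  T H̃ v = Σ (Fin r) λ i → NM H̃ i v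

  Sub : Set
  Sub = Fin r → Fin k → Bool

  τ : Sub → Vec Bool r
  τ H = tabulate (λ i → ⌊ k ≤? 2 * count (H i) ⌋)

  record XElem : Set where
    constructor x[_,_,_]
    pattern
    field
      xi : Fin r
      xσ : (v : V) → part v ≡ xi → Fin q
      xj : Fin k

  record YElem : Set where
    constructor y[_,_,_]
    pattern
    field
      yI : Sub
      yi : Fin r
      yj : Fin k

  UElem : Set
  UElem = XElem ⊎ YElem

  -- a (total) assignment σ : V → Σ violates no edge inside T (only its
  -- restriction to T matters; every σ ∈ Σ^T extends to such a total map)
  NoViolation : Vec Bool r → (V → Fin q) → Set
  NoViolation H̃ σ = ∀ x y → E x y ≡ true → T H̃ (inj₁ x) → T H̃ (inj₂ y) →
                     π x y (σ (inj₁ x)) ≡ σ (inj₂ y)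

  record Concept : Set where
    field
      I H : Sub
      σ : V → Fin q
      valid : NoViolation (τ H) σ

  _∈X_ : XElem → Concept → Set
  x[ i , σi , j ] ∈X C = (Concept.I C i j ≡ true) ×
     (∀ v (p : part v ≡ i) → NM (τ (Concept.H C)) i v → σi v p ≡ Concept.σ C v)

  _∈Y_ : YElem → Concept → Set
  y[ I′ , i , j ] ∈Y C = (Concept.H C i j ≡ true) × (I′ ≡ Concept.I C)

  _∈U_ : UElem → Concept → Set
  inj₁ x ∈U C = x ∈X C
  inj₂ y ∈U C = y ∈Y C

  InCS : List XElem → Concept → Set
  InCS S C = All (λ x → x ∈X C) S

  SameX : XElem → XElem → Set
  SameX x[ i , σ , j ] x[ i′ , σ′ , j′ ] =
    Σ (i ≡ i′) λ { _≡_.refl → (j ≡ j′) × (∀ v p → σ v p ≡ σ′ v p) }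

  NonRepetitive : List XElem → Set
  NonRepetitive S = ∀ x y → x ∈ S → y ∈ S →
    XElem.xi x ≡ XElem.xi y → XElem.xj x ≡ XElem.xj y → SameX x y

  inIJ : List XElem → Fin r → Fin k → Bool
  inIJ [] i j = false
  inIJ (x ∷ S) i j = (⌊ XElem.xi x ≟ i ⌋ ∧ ⌊ XElem.xj x ≟ j ⌋) Data.Bool.∨ inIJ S i j

  newIJ : List XElem → List XElem → ℕ
  newIJ P S = sum (tabulate (λ i → count (λ j → inIJ P i j ∧ not (inIJ S i j))))

  -- full binary trees of depth d whose internal nodes are labelled by 𝒳;
  -- node x t₀ t₁ : t₀ is the 0-child, t₁ the 1-child
  data Tree : ℕ → Set where
    leaf : Tree zero
    node : ∀ {d} → XElem → Tree d → Tree d → Tree (suc d)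

  -- leaves are s ∈ {0,1}^d, i.e. Vec Bool d (true = 1)
  -- C realises the root-to-leaf path s : v_{T,s≤i} ∈ C ⇔ s_{i+1} = 1
  Realises : ∀ {d} → Concept → Tree d → Vec Bool d → Set
  Realises C leaf [] = ⊤
  Realises C (node x t₀ t₁) (false ∷ s) = ¬ (x ∈X C) × Realises C t₀ s
  Realises C (node x t₀ t₁) (true ∷ s) = x ∈X C × Realises C t₁ s

  MistakeTree : ∀ {d} → List XElem → Tree d → Set
  MistakeTree {d} S t = ∀ (s : Vec Bool d) →
    Σ Concept λ C → InCS S C × Realises C t s

  -- ρ⁻¹_{𝒯,s}(1) : labels on the root-to-s path where the path goes to 1
  ones : ∀ {d} → Tree d → Vec Bool d → List XElem
  ones leaf [] = []
  ones (node x t₀ t₁) (false ∷ s) = ones t₀ s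
  ones (node x t₀ t₁) (true ∷ s) = x ∷ ones t₁ s

-- Follow any root-to-leaf path and track the set K of values τ(H) still
-- possible for the concepts realising the leaves below. At a node labelled
-- x_{i,σ,j} with (i,j) not yet seen on the 1-branches of the path nor in S_nr,
-- go right: this adds a new pair to IJ. Otherwise some x_{i,σ′,j} already lies
-- in every concept below, and then x_{i,σ,j} ∈ C_{I,H,σ″} holds iff σ and σ′
-- agree on N_i(M_{τ(H)}(i)), a property of τ(H) alone. The two children thus
-- use disjoint parts of K, and moving to the smaller part halves K; since
-- |K| ≤ 2^r this happens at most r times.
module Submission where

open import Defs
open import Data.Nat using (ℕ; _∸_; _≤_)
open import Data.Vec using (Vec)
open import Data.Bool using (Bool)
open import Data.List using (List)
open import Data.Product using (Σ)

open import Axiom.UniquenessOfIdentityProofs using (module Decidable⇒UIP)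
open import Data.Bool as Bool using (true; false; _∧_; _∨_; not; if_then_else_; f≤t; b≤b; f<t)
open import Data.Bool.Properties using (∧-zeroʳ)
open import Data.Fin using (Fin; zero; suc; toℕ; _≟_)
open import Data.Fin.Permutation using (_⟨$⟩ˡ_)
open import Data.Fin.Properties using (any?; all?)
open import Data.List using ([]; _∷_; _++_; length; map; filter)
open import Data.List.Membership.Propositional using (_∈_)
open import Data.List.Membership.Propositional.Properties using (∈-++⁺ˡ; ∈-++⁺ʳ; ∈-map⁺; ∈-filter⁺)
open import Data.List.Properties using (length-++; length-map)
open import Data.List.Relation.Unary.All using (_∷_; lookup)
open import Data.List.Relation.Unary.Any using (here; there)
open import Data.Nat as ℕ using (suc; _+_; _^_; _<_; z≤n; s≤s; _≤?_)
open import Data.Nat.Properties hiding (_≟_)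
open import Data.Product using (_×_; _,_; ∃; ∃-syntax)
open import Data.Sum using (_⊎_; inj₁; inj₂; [_,_])
open import Data.Vec using ([]; _∷_; tabulate; sum; replicate)
open import Function using (_∘_)
open import Relation.Binary.PropositionalEquality using (_≡_; refl; sym; trans; cong; cong₂; subst; module ≡-Reasoning)
open import Relation.Nullary using (Dec; yes; no; contradiction)
open import Relation.Nullary.Decidable using (map′; ¬?; _×-dec_; _→-dec_)
open import Relation.Unary.Properties using (∁?)

indicator : Bool → ℕ
indicator b = if b then 1 else 0

sum-tabulate-mono-≤ : ∀ {m} {f g : Fin m → ℕ} → (∀ x → f x ≤ g x) →
                      sum (tabulate f) ≤ sum (tabulate g)
sum-tabulate-mono-≤ {ℕ.zero} f≤g = z≤n
sum-tabulate-mono-≤ {suc _}  f≤g = +-mono-≤ (f≤g zero) (sum-tabulate-mono-≤ (f≤g ∘ suc))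

sum-tabulate-mono-< : ∀ {m} {f g : Fin m → ℕ} → (∀ x → f x ≤ g x) →
                      ∀ x₀ → f x₀ < g x₀ → sum (tabulate f) < sum (tabulate g)
sum-tabulate-mono-< f≤g zero    f<g = +-mono-<-≤ f<g (sum-tabulate-mono-≤ (f≤g ∘ suc))
sum-tabulate-mono-< f≤g (suc x₀) f<g = +-mono-≤-< (f≤g zero) (sum-tabulate-mono-< (f≤g ∘ suc) x₀ f<g)

indicator-mono-≤ : ∀ {b c} → b Bool.≤ c → indicator b ≤ indicator c
indicator-mono-≤ f≤t = z≤n
indicator-mono-≤ b≤b = ≤-refl

count-mono-≤ : ∀ {m} {f g : Fin m → Bool} → (∀ x → f x Bool.≤ g x) → count f ≤ count g
count-mono-≤ f≤g = sum-tabulate-mono-≤ (indicator-mono-≤ ∘ f≤g)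

count-mono-< : ∀ {m} {f g : Fin m → Bool} → (∀ x → f x Bool.≤ g x) →
               ∀ x₀ → f x₀ Bool.< g x₀ → count f < count g
count-mono-< f≤g x₀ f<g = sum-tabulate-mono-< (indicator-mono-≤ ∘ f≤g) x₀ (indicator-< f<g)
  where
  indicator-< : ∀ {b c} → b Bool.< c → indicator b < indicator c
  indicator-< f<t = s≤s z≤n

∧-not-∨-shift-≤ : ∀ h a s → a ∧ not (h ∨ s) Bool.≤ (h ∨ a) ∧ not s
∧-not-∨-shift-≤ true  a true  rewrite ∧-zeroʳ a = b≤b
∧-not-∨-shift-≤ true  a false rewrite ∧-zeroʳ a = f≤t
∧-not-∨-shift-≤ false _ _     = b≤b

module _ {A : Set} {P : A → Set} (P? : ∀ x → Dec (P x)) where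

  length-filter-+-length-filter-∁ : ∀ xs →
    length (filter P? xs) + length (filter (∁? P?) xs) ≡ length xs
  length-filter-+-length-filter-∁ [] = refl
  length-filter-+-length-filter-∁ (x ∷ xs) with ih ← length-filter-+-length-filter-∁ xs | P? x
  ... | yes _ = cong suc ih
  ... | no  _ = trans (+-suc _ _) (cong suc ih)

allBoolVecs : ∀ n → List (Vec Bool n)
allBoolVecs ℕ.zero    = [] ∷ []
allBoolVecs (suc n) = map (false ∷_) (allBoolVecs n) ++ map (true ∷_) (allBoolVecs n)

length-allBoolVecs : ∀ n → length (allBoolVecs n) ≡ 2 ^ n
length-allBoolVecs ℕ.zero  = refl
length-allBoolVecs (suc n) = begin
  length (map (false ∷_) vs ++ map (true ∷_) vs)             ≡⟨ length-++ (map (false ∷_) vs) ⟩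
  length (map (false ∷_) vs) + length (map (true ∷_) vs)     ≡⟨ cong₂ _+_ (length-map _ vs) (length-map _ vs) ⟩
  length vs + length vs                                      ≡⟨ cong₂ _+_ ih (trans ih (sym (+-identityʳ _))) ⟩
  2 ^ suc n                                                  ∎
  where
  open ≡-Reasoning
  vs = allBoolVecs n
  ih = length-allBoolVecs n

∈-allBoolVecs : ∀ {n} (v : Vec Bool n) → v ∈ allBoolVecs n
∈-allBoolVecs []          = here refl
∈-allBoolVecs (false ∷ v) = ∈-++⁺ˡ (∈-map⁺ (false ∷_) (∈-allBoolVecs v))
∈-allBoolVecs {suc n} (true ∷ v) =
  ∈-++⁺ʳ (map (false ∷_) (allBoolVecs n)) (∈-map⁺ (true ∷_) (∈-allBoolVecs v))

+≤2^suc⇒≤2^ : ∀ {a b} m → a + b ≤ 2 ^ suc m → a ≤ 2 ^ m ⊎ b ≤ 2 ^ m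
+≤2^suc⇒≤2^ {a} {b} m a+b≤ with a ≤? 2 ^ m
... | yes a≤ = inj₁ a≤
... | no  a≰ = inj₂ (+-cancelˡ-≤ (2 ^ m) b (2 ^ m) (begin
  2 ^ m + b   ≤⟨ +-monoˡ-≤ b (<⇒≤ (≰⇒> a≰)) ⟩
  a + b       ≤⟨ a+b≤ ⟩
  2 ^ suc m   ≡⟨ cong (2 ^ m +_) (+-identityʳ (2 ^ m)) ⟩
  2 ^ m + 2 ^ m ∎))
  where open ≤-Reasoning

module _ {A B : Set} {P : A ⊎ B → Set} where

  ∃-⊎-dec : Dec (∃ (P ∘ inj₁)) → Dec (∃ (P ∘ inj₂)) → Dec (∃ P)
  ∃-⊎-dec (yes (x , p)) _             = yes (inj₁ x , p)
  ∃-⊎-dec (no _)        (yes (y , p)) = yes (inj₂ y , p)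
  ∃-⊎-dec (no ¬p₁)      (no ¬p₂)      = no λ { (inj₁ x , p) → ¬p₁ (x , p) ; (inj₂ y , p) → ¬p₂ (y , p) }

  ∀-⊎-dec : Dec (∀ x → P (inj₁ x)) → Dec (∀ y → P (inj₂ y)) → Dec (∀ z → P z)
  ∀-⊎-dec p₁? p₂? = map′ (λ (p₁ , p₂) → [ p₁ , p₂ ]) (λ p → p ∘ inj₁ , p ∘ inj₂) (p₁? ×-dec p₂?)

module _ (L : LabelCover) (P : Construction L) where
  open LabelCover L
  open Construction P

  ∃V? : {Q : V → Set} → (∀ v → Dec (Q v)) → Dec (∃ Q)
  ∃V? Q? = ∃-⊎-dec (any? (Q? ∘ inj₁)) (any? (Q? ∘ inj₂))

  ∀V? : {Q : V → Set} → (∀ v → Dec (Q v)) → Dec (∀ v → Q v)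
  ∀V? Q? = ∀-⊎-dec (all? (Q? ∘ inj₁)) (all? (Q? ∘ inj₂))

  Adj? : ∀ v w → Dec (Adj v w)
  Adj? (inj₁ x) (inj₂ y) = E x y Bool.≟ true
  Adj? (inj₂ y) (inj₁ x) = E x y Bool.≟ true
  Adj? (inj₁ _) (inj₁ _) = no λ ()
  Adj? (inj₂ _) (inj₂ _) = no λ ()

  MatchedIn? : ∀ p i j → Dec (MatchedIn p i j)
  MatchedIn? p i j = ¬? (i ≟ j) ×-dec (toℕ (p ⟨$⟩ˡ i) ℕ./ 2 ℕ.≟ toℕ (p ⟨$⟩ˡ j) ℕ./ 2)

  M? : ∀ κ i j → Dec (M κ i j)
  M? κ i j = any? λ t → MatchedIn? (perms κ t) i j

  N? : ∀ i j v → Dec (N i j v)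
  N? i j v = (part v ≟ i) ×-dec ∃V? (λ w → Adj? v w ×-dec (part w ≟ j))

  NM? : ∀ κ i v → Dec (NM κ i v)
  NM? κ i v = any? λ j → M? κ i j ×-dec N? i j v

  Labelling : Fin r → Set
  Labelling i = (v : V) → part v ≡ i → Fin q

  Agree : Vec Bool r → (i : Fin r) → Labelling i → Labelling i → Set
  Agree κ i σ σ′ = ∀ v (p : part v ≡ i) → NM κ i v → σ v p ≡ σ′ v p

  agree? : ∀ i (σ σ′ : Labelling i) κ → Dec (Agree κ i σ σ′)
  agree? i σ σ′ κ = ∀V? agreeAt?
    where
    agreeAt? : ∀ v → Dec (∀ (p : part v ≡ i) → NM κ i v → σ v p ≡ σ′ v p)
    agreeAt? v with part v ≟ i
    ... | no  v∉Uᵢ = yes λ p → contradiction p v∉Uᵢ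
    ... | yes p₀   = map′ (λ agrees p → subst (λ p → NM κ i v → σ v p ≡ σ′ v p)
                                               (Decidable⇒UIP.≡-irrelevant _≟_ p₀ p) agrees)
                          (λ agrees → agrees p₀)
                          (NM? κ i v →-dec σ v p₀ ≟ σ′ v p₀)

  ∈X⇒Agree : ∀ {i σ σ′ j} C → x[ i , σ′ , j ] ∈X C → x[ i , σ , j ] ∈X C →
             Agree (τ (Concept.H C)) i σ σ′
  ∈X⇒Agree C (_ , σ′∼C) (_ , σ∼C) v p v∈NM = trans (σ∼C v p v∈NM) (sym (σ′∼C v p v∈NM))

  Agree⇒∈X : ∀ {i σ σ′ j} C → x[ i , σ′ , j ] ∈X C → Agree (τ (Concept.H C)) i σ σ′ →
             x[ i , σ , j ] ∈X C
  Agree⇒∈X C (ij∈I , σ′∼C) σ∼σ′ = ij∈I , λ v p v∈NM → trans (σ∼σ′ v p v∈NM) (σ′∼C v p v∈NM)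

  inIJ-head : ∀ x S → inIJ (x ∷ S) (XElem.xi x) (XElem.xj x) ≡ true
  inIJ-head x S with XElem.xi x ≟ XElem.xi x | XElem.xj x ≟ XElem.xj x
  ... | yes _ | yes _ = refl
  ... | no i≢i | _    = contradiction refl i≢i
  ... | yes _ | no j≢j = contradiction refl j≢j

  inIJ⇒∈ : ∀ S {i j} → inIJ S i j ≡ true → ∃[ x′ ] x′ ∈ S × XElem.xi x′ ≡ i × XElem.xj x′ ≡ j
  inIJ⇒∈ (x ∷ S) {i} {j} ij∈S with XElem.xi x ≟ i | XElem.xj x ≟ j
  ... | yes i≡ | yes j≡ = x , here refl , i≡ , j≡
  ... | yes _  | no _   = let x′ , x′∈S , ij≡ = inIJ⇒∈ S ij∈S in x′ , there x′∈S , ij≡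
  ... | no _   | _      = let x′ , x′∈S , ij≡ = inIJ⇒∈ S ij∈S in x′ , there x′∈S , ij≡

  newIJ-shift-≤ : ∀ A x S → newIJ A (x ∷ S) ≤ newIJ (x ∷ A) S
  newIJ-shift-≤ A x S = sum-tabulate-mono-≤ λ i → count-mono-≤ λ j →
    ∧-not-∨-shift-≤ _ (inIJ A i j) (inIJ S i j)

  newIJ-shift-< : ∀ A x S → inIJ S (XElem.xi x) (XElem.xj x) ≡ false →
                  newIJ A (x ∷ S) < newIJ (x ∷ A) S
  newIJ-shift-< A x@(x[ i , _ , j ]) S ij∉S =
    sum-tabulate-mono-< (λ i → count-mono-≤ (shift i)) i (count-mono-< (shift i) j ij-new)
    where
    shift = λ i j → ∧-not-∨-shift-≤ _ (inIJ A i j) (inIJ S i j)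
    ij-new : inIJ A i j ∧ not (inIJ (x ∷ S) i j) Bool.< inIJ (x ∷ A) i j ∧ not (inIJ S i j)
    ij-new rewrite inIJ-head x S | inIJ-head x A | ij∉S | ∧-zeroʳ (inIJ A i j) = f<t

  MistakeTreeWithin : ∀ {d} → List XElem → List (Vec Bool r) → Tree d → Set
  MistakeTreeWithin {d} S K t = ∀ (s : Vec Bool d) →
    Σ Concept λ C → InCS S C × Realises C t s × τ (Concept.H C) ∈ K

  mistakeTree⇒within : ∀ {d S} {t : Tree d} → MistakeTree S t → MistakeTreeWithin S (allBoolVecs r) t
  mistakeTree⇒within mt s = let C , C⊇S , realises = mt s in C , C⊇S , realises , ∈-allBoolVecs _

  within-nonempty : ∀ {d S K} {t : Tree d} → MistakeTreeWithin S K t → 0 < length K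
  within-nonempty {d} w with w (replicate d false)
  ... | _ , _ , _ , here _  = s≤s z≤n
  ... | _ , _ , _ , there _ = s≤s z≤n

  within-right : ∀ {d x S K} {t₀ t₁ : Tree d} →
                 MistakeTreeWithin S K (node x t₀ t₁) → MistakeTreeWithin (x ∷ S) K t₁
  within-right w s = let C , C⊇S , (x∈C , realises) , κ∈K = w (true ∷ s) in
    C , x∈C ∷ C⊇S , realises , κ∈K

  module _ {d i σ σ′ j S K} {t₀ t₁ : Tree d} (x′∈S : x[ i , σ′ , j ] ∈ S)
           (w : MistakeTreeWithin S K (node x[ i , σ , j ] t₀ t₁)) where

    within-agreeing : MistakeTreeWithin (x[ i , σ , j ] ∷ S) (filter (agree? i σ σ′) K) t₁
    within-agreeing s = let C , C⊇S , (x∈C , realises) , κ∈K = w (true ∷ s) in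
      C , x∈C ∷ C⊇S , realises ,
      ∈-filter⁺ (agree? i σ σ′) κ∈K (∈X⇒Agree C (lookup C⊇S x′∈S) x∈C)

    within-disagreeing : MistakeTreeWithin S (filter (∁? (agree? i σ σ′)) K) t₀
    within-disagreeing s = let C , C⊇S , (x∉C , realises) , κ∈K = w (false ∷ s) in
      C , C⊇S , realises ,
      ∈-filter⁺ (∁? (agree? i σ σ′)) κ∈K (x∉C ∘ Agree⇒∈X C (lookup C⊇S x′∈S))

  fresh-path : ∀ {d} (t : Tree d) S K m → length K ≤ 2 ^ m → MistakeTreeWithin S K t →
               ∃[ s ] d ≤ m + newIJ (ones t s) S
  fresh-path leaf _ _ _ _ _ = [] , z≤n
  fresh-path {suc d} (node x t₀ t₁) S K m |K|≤ w with inIJ S (XElem.xi x) (XElem.xj x) in seen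
  ... | false = let s , d≤ = fresh-path t₁ (x ∷ S) K m |K|≤ (within-right w) in true ∷ s , (begin
    suc d                                 ≤⟨ s≤s d≤ ⟩
    suc (m + newIJ (ones t₁ s) (x ∷ S))   ≡⟨ +-suc m _ ⟨
    m + suc (newIJ (ones t₁ s) (x ∷ S))   ≤⟨ +-monoʳ-≤ m (newIJ-shift-< (ones t₁ s) x S seen) ⟩
    m + newIJ (x ∷ ones t₁ s) S           ∎)
    where open ≤-Reasoning
  fresh-path {suc d} (node x@(x[ i , σ , j ]) t₀ t₁) S K m |K|≤ w | true
    with inIJ⇒∈ S seen
  ... | x[ _ , σ′ , _ ] , x′∈S , refl , refl = descend m |K|≤
    where
    agree-i? = agree? i σ σ′
    K₁ = filter agree-i? K
    K₀ = filter (∁? agree-i?) K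
    w₁ = within-agreeing x′∈S w
    w₀ = within-disagreeing x′∈S w

    |K₁|+|K₀|≤|K| : length K₁ + length K₀ ≤ length K
    |K₁|+|K₀|≤|K| = ≤-reflexive (length-filter-+-length-filter-∁ agree-i? K)

    descend : ∀ m → length K ≤ 2 ^ m → ∃[ s ] suc d ≤ m + newIJ (ones (node x t₀ t₁) s) S
    descend ℕ.zero |K|≤1 = contradiction
      (≤-trans (+-mono-≤ (within-nonempty w₁) (within-nonempty w₀)) (≤-trans |K₁|+|K₀|≤|K| |K|≤1))
      λ { (s≤s ()) }
    descend (suc m) |K|≤ with +≤2^suc⇒≤2^ m (≤-trans |K₁|+|K₀|≤|K| |K|≤)
    ... | inj₁ |K₁|≤ = let s , d≤ = fresh-path t₁ (x ∷ S) K₁ m |K₁|≤ w₁ in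
      true ∷ s , s≤s (≤-trans d≤ (+-monoʳ-≤ m (newIJ-shift-≤ (ones t₁ s) x S)))
    ... | inj₂ |K₀|≤ = let s , d≤ = fresh-path t₀ S K₀ m |K₀|≤ w₀ in
      false ∷ s , s≤s d≤

lemma24 : (L : LabelCover) (P : Construction L) →
    let open Construction P in
    (Snr : List XElem) → NonRepetitive Snr →
    (d : ℕ) (𝒯 : Tree d) → MistakeTree Snr 𝒯 →
    Σ (Vec Bool d) λ s → d ∸ r ≤ newIJ (ones 𝒯 s) Snr
lemma24 L P Snr _ d 𝒯 mt =
  let s , d≤ = fresh-path L P 𝒯 Snr (allBoolVecs r) r (≤-reflexive (length-allBoolVecs r))
                 (mistakeTree⇒within L P mt)
  in s , m≤n+o⇒m∸n≤o d r d≤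
  where open Construction P using (r)
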